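{- Let $r\geq3$ be an odd integer. Then $H\in M_r(4)$. Moreover, for all integers $n\geq k\geq4$, if $G\in M_r(n)$ contains a bad cycle $(z_1,\ldots,z_k)$, then $G\in M_r(n)\setminus C_r(n)$. In particular, if $G\in M_r(n)$ contains a copy of $H$, then $G\notin C_r(n)$.
   Context: $[r]=\{1,\ldots,r\}$, $[i,j]=\{i,\ldots,j\}$, $m(r)=\lceil\frac{r+1}2\rceil$. An $r$-graph is a pair $G=(V,c)$ with $c:\binom V2\to2^{[r]}$; simple means $|c(e)|\leq1$, complete means $c(e)\neq\emptyset$ for all $e$; for simple complete $G$, $d^G(x,y)$ is the unique element of $c(xy)$. $M_r(n)$ is the set of simple complete $r$-graphs $([n],c)$ with $d(x,z)\leq d(x,y)+d(y,z)$ for all pairwise distinct $x,y,z$. For odd $r$, $C_r(n)$ is the set of simple complete $r$-graphs $([n],c)$ for which there is a partition $V_1\cup\cdots\cup V_t$ of $[n]$ with $c(xy)\subseteq[\frac{r-1}2,r-1]$ when $x,y$ lie in a common part and $c(xy)\subseteq[\frac{r+1}2,r]$ when they lie in different parts. $H$ is the simple complete $r$-graph on $[4]$ with $d^H(1,3)=d^H(2,4)=r-1$, $d^H(1,4)=r$, and $d^H(1,2)=d^H(2,3)=d^H(3,4)=m(r)-1$. A bad cycle in $G\in M_r(n)$ is a sequence $(z_1,\ldots,z_k)$ of distinct elements of $[n]$ with $d^G(z_i,z_{i+1})=m(r)-1$ for $1\leq i\leq k-1$ and $d^G(z_1,z_k)=r$. $G$ contains a copy of $H$ if there are $x_1,\ldots,x_4\in[n]$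 with $c^G(x_sx_t)=c^H(st)$ for all $1\leq s<t\leq4$. -}

module Defs where

open import Data.Nat using (ℕ; zero; suc; _+_; _*_; _∸_; _≤_; _<_; ⌈_/2⌉; ⌊_/2⌋; _≡ᵇ_)
open import Data.Fin using (Fin; toℕ; zero; suc)
open import Data.Fin.Subset using (Subset; _∈_; ∣_∣; Nonempty)
open import Data.Vec using (tabulate)
open import Data.Product using (Σ; ∃; _×_; _,_)
open import Relation.Binary.PropositionalEquality using (_≡_; _≢_; refl)
open import Relation.Nullary using (¬_)

Odd : ℕ → Set
Odd r = ∃ λ s → r ≡ suc (2 * s)

m : ℕ → ℕ
m r = ⌈ suc r /2⌉

-- Colours [r] = {1..r} are represented by
-- Fin r, the element j standing for the colour suc (toℕ j).
-- c is given on ordered pairs and required symmetric, so it is a function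
-- on unordered pairs; its values on the diagonal (x , x) are irrelevant.
record RGraph (r n : ℕ) : Set where
  field
    c     : Fin n → Fin n → Subset r
    c-sym : ∀ x y → c x y ≡ c y x
open RGraph public

module _ {r n : ℕ} (G : RGraph r n) where

  IsSimple : Set
  IsSimple = ∀ x y → x ≢ y → ∣ c G x y ∣ ≤ 1

  IsComplete : Set
  IsComplete = ∀ x y → x ≢ y → Nonempty (c G x y)

  -- "k ∈ c(xy)"; for simple complete G this says exactly d^G(x,y) = k.
  Dist : Fin n → Fin n → ℕ → Set
  Dist x y k = Σ (Fin r) λ j → j ∈ c G x y × suc (toℕ j) ≡ k

  InM : Set
  InM = IsSimple × IsComplete ×
        (∀ x y z → x ≢ y → y ≢ z → x ≢ z →
          ∀ a b e → Dist x z a → Dist x y b → Dist y z e → a ≤ b + e)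

  -- G ∈ C_r(n) (r odd): a partition of Fin n given by a part-labelling
  -- function p (x, y in a common part iff p x ≡ p y); every colour in c(xy)
  -- lies in [(r-1)/2, r-1] within a part and in [(r+1)/2, r] across parts.
  InC : Set
  InC = IsSimple × IsComplete ×
        (Σ (Fin n → Fin n) λ p → ∀ x y → x ≢ y → ∀ k → Dist x y k →
          (p x ≡ p y → (⌊ r ∸ 1 /2⌋ ≤ k) × (k ≤ r ∸ 1)) ×
          (p x ≢ p y → (⌊ suc r /2⌋ ≤ k) × (k ≤ r)))

  -- (z_1,...,z_k) is a bad cycle in G (indices 0..k-1 here)
  BadCycle : (k : ℕ) → (Fin k → Fin n) → Set
  BadCycle k z =
    (∀ i j → i ≢ j → z i ≢ z j) ×
    (∀ i j → toℕ j ≡ suc (toℕ i) → Dist (z i) (z j) (m r ∸ 1)) ×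
    (∀ i j → toℕ i ≡ 0 → toℕ j ≡ k ∸ 1 → Dist (z i) (z j) r)

single : (r k : ℕ) → Subset r
single r k = tabulate λ (j : Fin r) → suc (toℕ j) ≡ᵇ k

-- d^H on vertices 0,1,2,3 (standing for 1,2,3,4); diagonal value unused
dH : ℕ → Fin 4 → Fin 4 → ℕ
dH r zero zero = 0
dH r zero (suc zero) = m r ∸ 1
dH r zero (suc (suc zero)) = r ∸ 1
dH r zero (suc (suc (suc zero))) = r
dH r (suc zero) zero = m r ∸ 1
dH r (suc zero) (suc zero) = 0
dH r (suc zero) (suc (suc zero)) = m r ∸ 1
dH r (suc zero) (suc (suc (suc zero))) = r ∸ 1
dH r (suc (suc zero)) zero = r ∸ 1
dH r (suc (suc zero)) (suc zero) = m r ∸ 1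
dH r (suc (suc zero)) (suc (suc zero)) = 0
dH r (suc (suc zero)) (suc (suc (suc zero))) = m r ∸ 1
dH r (suc (suc (suc zero))) zero = r
dH r (suc (suc (suc zero))) (suc zero) = r ∸ 1
dH r (suc (suc (suc zero))) (suc (suc zero)) = m r ∸ 1
dH r (suc (suc (suc zero))) (suc (suc (suc zero))) = 0

dH-sym : ∀ r x y → dH r x y ≡ dH r y x
dH-sym r zero zero = refl
dH-sym r zero (suc zero) = refl
dH-sym r zero (suc (suc zero)) = refl
dH-sym r zero (suc (suc (suc zero))) = refl
dH-sym r (suc zero) zero = refl
dH-sym r (suc zero) (suc zero) = refl
dH-sym r (suc zero) (suc (suc zero)) = refl
dH-sym r (suc zero) (suc (suc (suc zero))) = refl
dH-sym r (suc (suc zero)) zero = refl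
dH-sym r (suc (suc zero)) (suc zero) = refl
dH-sym r (suc (suc zero)) (suc (suc zero)) = refl
dH-sym r (suc (suc zero)) (suc (suc (suc zero))) = refl
dH-sym r (suc (suc (suc zero))) zero = refl
dH-sym r (suc (suc (suc zero))) (suc zero) = refl
dH-sym r (suc (suc (suc zero))) (suc (suc zero)) = refl
dH-sym r (suc (suc (suc zero))) (suc (suc (suc zero))) = refl

H : (r : ℕ) → RGraph r 4
H r = record
  { c = λ x y → single r (dH r x y)
  ; c-sym = λ x y → cong-single (dH-sym r x y) }
  where
  cong-single : ∀ {a b} → a ≡ b → single r a ≡ single r b
  cong-single refl = refl

ContainsH : {r n : ℕ} → RGraph r n → Set
ContainsH {r} {n} G =
  Σ (Fin 4 → Fin n) λ x →
    (∀ s t → s ≢ t → x s ≢ x t) ×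
    (∀ s t → s ≢ t → c G (x s) (x t) ≡ c (H r) s t)

-- For r = 2s + 1, colour s is too short to join two parts of a partition witnessing
-- membership in C_r, while colour r is too long to lie inside one part.  Along a bad
-- cycle the part is therefore constant, yet its two ends are joined by colour r.
-- The graph H is the path 1-2-3-4 with step s, i.e. the truncated line metric
-- min(s |x - y|, r), so it is in M_r(4) and (1,2,3,4) is a bad cycle in every copy.
module Submission where

open import Defs
open import Data.Bool.Properties using (T-≡)
open import Data.Fin using (Fin; zero; suc; toℕ; fromℕ; fromℕ<; _≟_)
open import Data.Fin.Properties using (toℕ-injective; toℕ-fromℕ; toℕ-fromℕ<)
open import Data.Fin.Subset using (Subset; _∈_; ∣_∣; ⁅_⁆)
open import Data.Fin.Subset.Properties
  using (nonempty?; Empty-unique; ∣⊥∣≡0; ∣⁅x⁆∣≡1; x∈⁅x⁆; p⊆q⇒∣p∣≤∣q∣)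
open import Data.Nat using (ℕ; zero; suc; _+_; _*_; _∸_; _≤_; _<_; _⊓_; ∣_-_∣;
  ⌊_/2⌋; ⌈_/2⌉; _≡ᵇ_; z≤n; s≤s)
open import Data.Nat.Properties
  using (≤-trans; ≤-reflexive; ≤-total; <⇒≱; n≮n; 1+n≢n; suc-injective; ≡ᵇ⇒≡; ≡⇒≡ᵇ;
    m≤m+n; m≤n+m; n≤1+n; +-identityʳ; *-identityˡ; +-monoˡ-≤; *-monoˡ-≤; *-mono-≤;
    *-distribʳ-+; m⊓n≤m; m⊓n≤n; ⊓-glb; m≤n⇒m⊓n≡m; m≥n⇒m⊓n≡n; n≢0⇒n>0;
    ∣m-n∣≡0⇒m≡n; ∣-∣-triangle; n≡⌊n+n/2⌋; n≡⌈n+n/2⌉; module ≤-Reasoning)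
open import Data.Product using (_×_; _,_; proj₁; proj₂)
open import Data.Sum using (inj₁; inj₂)
open import Data.Vec.Properties using ([]=⇒lookup; lookup⇒[]=; lookup∘tabulate)
open import Function using (_∘_; Equivalence)
open import Relation.Binary.PropositionalEquality
open import Relation.Nullary using (¬_; yes; no; contradiction)

all-equal⇒∣p∣≤1 : ∀ {n} {p : Subset n} → (∀ {i j} → i ∈ p → j ∈ p → i ≡ j) → ∣ p ∣ ≤ 1
all-equal⇒∣p∣≤1 {n} {p} unique with nonempty? p
... | yes (i , i∈p) =
  subst (∣ p ∣ ≤_) (∣⁅x⁆∣≡1 i)
    (p⊆q⇒∣p∣≤∣q∣ λ j∈p → subst (_∈ ⁅ i ⁆) (unique i∈p j∈p) (x∈⁅x⁆ i))
... | no empty = ≤-trans (≤-reflexive (trans (cong ∣_∣ (Empty-unique empty)) (∣⊥∣≡0 n))) z≤n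

∈-single⁻ : ∀ {r k} {j : Fin r} → j ∈ single r k → suc (toℕ j) ≡ k
∈-single⁻ {k = k} {j} j∈ =
  ≡ᵇ⇒≡ _ _ (Equivalence.from T-≡
    (trans (sym (lookup∘tabulate (λ i → suc (toℕ i) ≡ᵇ k) j)) ([]=⇒lookup j∈)))

∈-single⁺ : ∀ {r k} (j : Fin r) → suc (toℕ j) ≡ k → j ∈ single r k
∈-single⁺ {k = k} j eq =
  lookup⇒[]= j _
    (trans (lookup∘tabulate (λ i → suc (toℕ i) ≡ᵇ k) j) (Equivalence.to T-≡ (≡⇒≡ᵇ _ _ eq)))

∣single∣≤1 : ∀ r k → ∣ single r k ∣ ≤ 1
∣single∣≤1 r k = all-equal⇒∣p∣≤1 {p = single r k} λ i∈ j∈ →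
  toℕ-injective (suc-injective (trans (∈-single⁻ {k = k} i∈) (sym (∈-single⁻ {k = k} j∈))))

module _ {r n : ℕ} (G : RGraph r n) {x y : Fin n} (k : ℕ) (c≡ : c G x y ≡ single r k) where

  Dist-single⁺ : 1 ≤ k → k ≤ r → Dist G x y k
  Dist-single⁺ (s≤s {n = k′} _) k≤r =
    fromℕ< k≤r , subst (_ ∈_) (sym c≡) (∈-single⁺ _ eq) , eq
    where
    eq : suc (toℕ (fromℕ< k≤r)) ≡ suc k′
    eq = cong suc (toℕ-fromℕ< k≤r)

  Dist-single⁻ : ∀ {a} → Dist G x y a → a ≡ k
  Dist-single⁻ (j , j∈ , refl) = ∈-single⁻ {k = k} (subst (j ∈_) c≡ j∈)

InM-from-metric : ∀ {r n} (G : RGraph r n) (d : Fin n → Fin n → ℕ) →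
  (∀ {x y} → x ≢ y → c G x y ≡ single r (d x y)) →
  (∀ {x y} → x ≢ y → 1 ≤ d x y × d x y ≤ r) →
  (∀ {x y z} → x ≢ y → y ≢ z → x ≢ z → d x z ≤ d x y + d y z) →
  InM G
InM-from-metric {r} G d c≡ range triangle = simple , complete , metric
  where
  simple : IsSimple G
  simple x y x≢y = subst (λ p → ∣ p ∣ ≤ 1) (sym (c≡ x≢y)) (∣single∣≤1 r (d x y))

  complete : IsComplete G
  complete x y x≢y with Dist-single⁺ G (d x y) (c≡ x≢y) (proj₁ (range x≢y)) (proj₂ (range x≢y))
  ... | j , j∈ , _ = j , j∈

  metric : ∀ x y z → x ≢ y → y ≢ z → x ≢ z →
    ∀ a b e → Dist G x z a → Dist G x y b → Dist G y z e → a ≤ b + e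
  metric x y z x≢y y≢z x≢z a b e da db de = begin
    a               ≡⟨ Dist-single⁻ G (d x z) (c≡ x≢z) da ⟩
    d x z           ≤⟨ triangle {x} {y} {z} x≢y y≢z x≢z ⟩
    d x y + d y z   ≡⟨ cong₂ _+_ (Dist-single⁻ G (d x y) (c≡ x≢y) db)
                                 (Dist-single⁻ G (d y z) (c≡ y≢z) de) ⟨
    b + e           ∎
    where open ≤-Reasoning

⊓-subadditive : ∀ {a b c} k → a ≤ b + c → a ⊓ k ≤ b ⊓ k + c ⊓ k
⊓-subadditive {a} {b} {c} k a≤b+c with ≤-total k b | ≤-total k c
... | inj₁ k≤b | _ = begin
  a ⊓ k           ≤⟨ m⊓n≤n a k ⟩
  k               ≡⟨ m≥n⇒m⊓n≡n k≤b ⟨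
  b ⊓ k           ≤⟨ m≤m+n (b ⊓ k) (c ⊓ k) ⟩
  b ⊓ k + c ⊓ k   ∎
  where open ≤-Reasoning
... | inj₂ _ | inj₁ k≤c = begin
  a ⊓ k           ≤⟨ m⊓n≤n a k ⟩
  k               ≡⟨ m≥n⇒m⊓n≡n k≤c ⟨
  c ⊓ k           ≤⟨ m≤n+m (c ⊓ k) (b ⊓ k) ⟩
  b ⊓ k + c ⊓ k   ∎
  where open ≤-Reasoning
... | inj₂ b≤k | inj₂ c≤k = begin
  a ⊓ k           ≤⟨ m⊓n≤m a k ⟩
  a               ≤⟨ a≤b+c ⟩
  b + c           ≡⟨ cong₂ _+_ (m≤n⇒m⊓n≡m b≤k) (m≤n⇒m⊓n≡m c≤k) ⟨
  b ⊓ k + c ⊓ k   ∎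
  where open ≤-Reasoning

truncatedLine : ∀ {n} → ℕ → ℕ → Fin n → Fin n → ℕ
truncatedLine s k x y = (∣ toℕ x - toℕ y ∣ * s) ⊓ k

truncatedLine-triangle : ∀ {n} s k (x y z : Fin n) →
  truncatedLine s k x z ≤ truncatedLine s k x y + truncatedLine s k y z
truncatedLine-triangle s k x y z = ⊓-subadditive {b = ∣ u - v ∣ * s} {∣ v - w ∣ * s} k (begin
  ∣ u - w ∣ * s                   ≤⟨ *-monoˡ-≤ s (∣-∣-triangle u v w) ⟩
  (∣ u - v ∣ + ∣ v - w ∣) * s     ≡⟨ *-distribʳ-+ s ∣ u - v ∣ ∣ v - w ∣ ⟩
  ∣ u - v ∣ * s + ∣ v - w ∣ * s   ∎)
  where
  open ≤-Reasoning
  u = toℕ x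
  v = toℕ y
  w = toℕ z

truncatedLine-range : ∀ {n s k} {x y : Fin n} → 1 ≤ s → 1 ≤ k → x ≢ y →
  1 ≤ truncatedLine s k x y × truncatedLine s k x y ≤ k
truncatedLine-range {s = s} {k} {x} {y} 1≤s 1≤k x≢y =
  ⊓-glb (*-mono-≤ 1≤gap 1≤s) 1≤k , m⊓n≤n _ k
  where
  1≤gap : 1 ≤ ∣ toℕ x - toℕ y ∣
  1≤gap = n≢0⇒n>0 (x≢y ∘ toℕ-injective ∘ ∣m-n∣≡0⇒m≡n)

⌊2*n/2⌋≡n : ∀ n → ⌊ 2 * n /2⌋ ≡ n
⌊2*n/2⌋≡n n = sym (trans (n≡⌊n+n/2⌋ n) (cong (λ t → ⌊ n + t /2⌋) (sym (+-identityʳ n))))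

⌊1+2*n/2⌋≡n : ∀ n → ⌊ suc (2 * n) /2⌋ ≡ n
⌊1+2*n/2⌋≡n n = sym (trans (n≡⌈n+n/2⌉ n) (cong (λ t → ⌈ n + t /2⌉) (sym (+-identityʳ n))))

-- m r ∸ 1 is definitionally ⌊ r /2⌋, which is s for r = 2s + 1.
dH≡truncatedLine : ∀ {s} → 1 ≤ s → ∀ {x y : Fin 4} → x ≢ y →
  dH (suc (2 * s)) x y ≡ truncatedLine s (suc (2 * s)) x y
dH≡truncatedLine {s} 1≤s {x} {y} x≢y = go x y x≢y
  where
  r = suc (2 * s)

  gap₁ : m r ∸ 1 ≡ (1 * s) ⊓ r
  gap₁ = trans (⌊1+2*n/2⌋≡n s) (sym (trans (m≤n⇒m⊓n≡m 1*s≤r) (*-identityˡ s)))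
    where
    1*s≤r : 1 * s ≤ r
    1*s≤r = ≤-trans (*-monoˡ-≤ s (s≤s (z≤n {1}))) (n≤1+n (2 * s))

  gap₂ : r ∸ 1 ≡ (2 * s) ⊓ r
  gap₂ = sym (m≤n⇒m⊓n≡m (n≤1+n (2 * s)))

  gap₃ : r ≡ (3 * s) ⊓ r
  gap₃ = sym (m≥n⇒m⊓n≡n (+-monoˡ-≤ (2 * s) 1≤s))

  go : ∀ x y → x ≢ y → dH r x y ≡ truncatedLine s r x y
  go zero                   zero                   x≢y = contradiction refl x≢y
  go zero                   (suc zero)             _   = gap₁
  go zero                   (suc (suc zero))       _   = gap₂
  go zero                   (suc (suc (suc zero))) _   = gap₃
  go (suc zero)             zero                   _   = gap₁
  go (suc zero)             (suc zero)             x≢y = contradiction refl x≢y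
  go (suc zero)             (suc (suc zero))       _   = gap₁
  go (suc zero)             (suc (suc (suc zero))) _   = gap₂
  go (suc (suc zero))       zero                   _   = gap₂
  go (suc (suc zero))       (suc zero)             _   = gap₁
  go (suc (suc zero))       (suc (suc zero))       x≢y = contradiction refl x≢y
  go (suc (suc zero))       (suc (suc (suc zero))) _   = gap₁
  go (suc (suc (suc zero))) zero                   _   = gap₃
  go (suc (suc (suc zero))) (suc zero)             _   = gap₂
  go (suc (suc (suc zero))) (suc (suc zero))       _   = gap₁
  go (suc (suc (suc zero))) (suc (suc (suc zero))) x≢y = contradiction refl x≢y

H-InM : ∀ s → 1 ≤ s → InM (H (suc (2 * s)))
H-InM s 1≤s = InM-from-metric (H r) (truncatedLine s r)
  (cong (single r) ∘ dH≡truncatedLine 1≤s)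
  (truncatedLine-range 1≤s (s≤s z≤n))
  (λ {x} {y} {z} _ _ _ → truncatedLine-triangle s r x y z)
  where
  r = suc (2 * s)

dH-successor : ∀ r (i j : Fin 4) → toℕ j ≡ suc (toℕ i) → dH r i j ≡ m r ∸ 1
dH-successor r zero (suc zero) _ = refl
dH-successor r (suc zero) (suc (suc zero)) _ = refl
dH-successor r (suc (suc zero)) (suc (suc (suc zero))) _ = refl

module Parts {r n : ℕ} {G : RGraph r n} (G∈C : InC G) where

  part : Fin n → Fin n
  part = proj₁ (proj₂ (proj₂ G∈C))

  private
    bounds = proj₂ (proj₂ (proj₂ G∈C))

  short-colour⇒same-part : ∀ {x y k} → x ≢ y → Dist G x y k → k < ⌊ suc r /2⌋ → part x ≡ part y
  short-colour⇒same-part {x} {y} x≢y d k< with part x ≟ part y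
  ... | yes same = same
  ... | no different = contradiction (proj₁ (proj₂ (bounds x y x≢y _ d) different)) (<⇒≱ k<)

  colour-r⇒different-parts : ∀ {x y} → 1 ≤ r → x ≢ y → Dist G x y r → part x ≢ part y
  colour-r⇒different-parts {x} {y} (s≤s {n = r′} _) x≢y d same =
    n≮n r′ (proj₂ (proj₁ (bounds x y x≢y _ d) same))

successor⇒≢ : ∀ {k} {i j : Fin k} → toℕ j ≡ suc (toℕ i) → i ≢ j
successor⇒≢ j≡1+i i≡j = 1+n≢n (trans (sym j≡1+i) (cong toℕ (sym i≡j)))

constant-along-path : ∀ {A : Set} {k} (f : Fin (suc k) → A) →
  (∀ i j → toℕ j ≡ suc (toℕ i) → f i ≡ f j) → ∀ i → f zero ≡ f i
constant-along-path f step zero = refl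
constant-along-path {k = suc k} f step (suc i) =
  trans (step zero (suc zero) refl)
        (constant-along-path (f ∘ suc) (λ i j j≡1+i → step (suc i) (suc j) (cong suc j≡1+i)) i)

BadCycle⇒¬InC : ∀ {s n k} (G : RGraph (suc (2 * s)) n) {z : Fin k → Fin n} →
  2 ≤ k → BadCycle G k z → ¬ InC G
BadCycle⇒¬InC {s} {k = suc (suc k)} G {z} (s≤s (s≤s _)) (distinct , short , ends) G∈C =
  colour-r⇒different-parts (s≤s z≤n) (distinct zero last λ ()) (ends zero last refl (toℕ-fromℕ (suc k)))
    (constant-along-path (part ∘ z) same-part last)
  where
  open Parts {G = G} G∈C

  last : Fin (suc (suc k))
  last = fromℕ (suc k)

  s<⌊1+r/2⌋ : m (suc (2 * s)) ∸ 1 < ⌊ suc (suc (2 * s)) /2⌋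
  s<⌊1+r/2⌋ = s≤s (≤-reflexive (trans (⌊1+2*n/2⌋≡n s) (sym (⌊2*n/2⌋≡n s))))

  same-part : ∀ i j → toℕ j ≡ suc (toℕ i) → part (z i) ≡ part (z j)
  same-part i j j≡1+i =
    short-colour⇒same-part (distinct i j (successor⇒≢ j≡1+i)) (short i j j≡1+i) s<⌊1+r/2⌋

ContainsH⇒BadCycle : ∀ {s n} {G : RGraph (suc (2 * s)) n} → 1 ≤ s →
  (copy : ContainsH G) → BadCycle G 4 (proj₁ copy)
ContainsH⇒BadCycle {s} {G = G} 1≤s (x , distinct , c≡) = distinct , successive , ends
  where
  r = suc (2 * s)

  copy-Dist : ∀ {i j} → i ≢ j → Dist G (x i) (x j) (dH r i j)
  copy-Dist {i} {j} i≢j = Dist-single⁺ G (dH r i j) (c≡ i j i≢j) (proj₁ range) (proj₂ range)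
    where
    range : 1 ≤ dH r i j × dH r i j ≤ r
    range = subst (λ d → 1 ≤ d × d ≤ r) (sym (dH≡truncatedLine 1≤s i≢j))
                  (truncatedLine-range 1≤s (s≤s z≤n) i≢j)

  successive : ∀ i j → toℕ j ≡ suc (toℕ i) → Dist G (x i) (x j) (m r ∸ 1)
  successive i j j≡1+i =
    subst (Dist G (x i) (x j)) (dH-successor r i j j≡1+i) (copy-Dist (successor⇒≢ j≡1+i))

  ends : ∀ i j → toℕ i ≡ 0 → toℕ j ≡ 3 → Dist G (x i) (x j) r
  ends i j i≡0 j≡3 =
    subst₂ (λ i j → Dist G (x i) (x j) r)
      (sym (toℕ-injective {j = zero} i≡0)) (sym (toℕ-injective {j = fromℕ 3} j≡3)) (copy-Dist λ ())

lemma8p2 : (r : ℕ) → 3 ≤ r → Odd r →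
    InM (H r) ×
    (∀ (n k : ℕ) → 4 ≤ k → k ≤ n → (G : RGraph r n) → InM G →
      (z : Fin k → Fin n) → BadCycle G k z → InM G × ¬ InC G) ×
    (∀ (n : ℕ) → (G : RGraph r n) → InM G → ContainsH G → ¬ InC G)
lemma8p2 _ (s≤s (s≤s _)) (zero , ())
lemma8p2 _ _ (s@(suc _) , refl) =
  H-InM s 1≤s ,
  (λ _ _ 4≤k _ G G∈M _ bad → G∈M , BadCycle⇒¬InC {s} G (≤-trans (s≤s (s≤s z≤n)) 4≤k) bad) ,
  (λ _ G _ copy → BadCycle⇒¬InC {s} G (s≤s (s≤s z≤n)) (ContainsH⇒BadCycle {G = G} 1≤s copy))
  where
  1≤s : 1 ≤ s
  1≤s = s≤s z≤n
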